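{- Let $k\ge 9$ be an odd integer. Then the graph $\mathrm{X}(k)$ is vertex-transitive.
   Context: For a positive integer $k$ and $r,s\in\mathbb{Z}_{2k}$, $T_1(k,r,s)$ is the graph with vertex set $\{u_i,v_i,w_i: i\in\mathbb{Z}_{2k}\}$ and edges $u_iu_{i+k}$, $u_iv_i$, $u_iw_i$, $v_iw_{i+r}$, $v_iw_{i+s}$ ($i\in\mathbb{Z}_{2k}$). For odd positive $k$, let $r^*\in\mathbb{Z}_{2k}$ be $\frac{k+3}{2}$ if $k\equiv1\pmod 4$ and $\frac{k+3}{2}+k$ if $k\equiv 3\pmod 4$, and $\mathrm{X}(k)=T_1(k,r^*,1)$. -}

module Defs where

open import Data.Nat using (ℕ; zero; suc; _+_; _*_; ⌊_/2⌋; _%_)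
open import Data.Nat.DivMod using (m%n<n)
open import Data.Fin using (Fin; toℕ; fromℕ<)
open import Data.Product using (_×_; _,_; Σ)
open import Data.Sum using (_⊎_)
open import Relation.Binary.PropositionalEquality using (_≡_)
open import Function.Bundles using (_↔_; Inverse)
open import Data.Bool using (if_then_else_)
open import Data.Nat using (_≡ᵇ_)

-- ℤ_n realised as Fin n; adding a natural number r to i ∈ ℤ_n (mod n).
_+ₘ_ : ∀ {n} → Fin n → ℕ → Fin n
_+ₘ_ {suc n} i r = fromℕ< (m%n<n (toℕ i + r) (suc n))

-- r* for odd k, as a natural number representative (reduced mod 2k when used)
rstar : ℕ → ℕ
rstar k = if (k % 4 ≡ᵇ 1) then ⌊ k + 3 /2⌋ else ⌊ k + 3 /2⌋ + k

data Kind : Set where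
  U V W : Kind

-- vertices of T₁(k,r,s): (family, index in ℤ_{2k})
Vertex : ℕ → Set
Vertex k = Kind × Fin (2 * k)

data Edge (k r s : ℕ) : Vertex k → Vertex k → Set where
  uu : ∀ i → Edge k r s (U , i) (U , i +ₘ k)
  uv : ∀ i → Edge k r s (U , i) (V , i)
  uw : ∀ i → Edge k r s (U , i) (W , i)
  vwr : ∀ i → Edge k r s (V , i) (W , i +ₘ r)
  vws : ∀ i → Edge k r s (V , i) (W , i +ₘ s)

Adj : (k r s : ℕ) → Vertex k → Vertex k → Set
Adj k r s x y = Edge k r s x y ⊎ Edge k r s y x

AdjX : (k : ℕ) → Vertex k → Vertex k → Set
AdjX k = Adj k (rstar k) 1

IsAutomorphism : ∀ {A : Set} → (A → A → Set) → (A ↔ A) → Set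
IsAutomorphism {A} E f =
  ∀ x y → (E x y → E (Inverse.to f x) (Inverse.to f y)) × (E (Inverse.to f x) (Inverse.to f y) → E x y)

VertexTransitive : ∀ {A : Set} → (A → A → Set) → Set
VertexTransitive {A} E = ∀ x y → Σ (A ↔ A) (λ f → IsAutomorphism E f × (Inverse.to f x ≡ y))

module Submission where

-- In T₁(k, r, 1) an edge u_iu_{i+k}, u_iv_i, u_iw_i, v_iw_{i+r}, v_iw_{i+1} is recorded by its
-- kinds and its offset d ∈ {k, 0, 0, r, 1}; a map preserves adjacency as soon as it preserves
-- every offset on representatives.  Three families of automorphisms are built on this:
--   * the rotations (X, i) ↦ (X, i + c);
--   * the mirror (U, i) ↦ (U, -i), (V, i) ↦ (W, -i), (W, i) ↦ (V, -i);
--   * the twist, a reflection i ↦ c - i whose target kind and centre c depend on the kind and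
--     the parity of i (parity is well defined on ℤ_{2k}); it is an automorphism when k is odd,
--     r is even and 2r ≡ k + 3 (mod 2k).
-- Mirror and twist are instances of one lemma on parity-dependent reflections reducing edge
-- preservation to congruences between centres.  Rotations are transitive on each kind, the twist
-- sends u₀ to v₀ and the mirror v₀ to w₀, so every vertex is an image of u₀.  Finally r* meets
-- the hypotheses on r for every odd k.

open import Defs
open import Data.Nat as ℕ using (ℕ; zero; suc; _<_; _≤_; ⌊_/2⌋; parity)
import Data.Nat.Tactic.RingSolver as ℕ-Solver
open import Data.Nat.Divisibility using (divides)
import Data.Nat.Properties as ℕP
open import Data.Nat.DivMod using (m%n<n; m≡m%n+[m/n]*n; _%_; _/_; [m+kn]%n≡m%n; m∣n⇒o%n%m≡o%m)
open import Data.Integer using (ℤ; +_; -[1+_]; _+_; _*_; -_; _-_)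
import Data.Integer.Properties as ℤP
open import Data.Integer.DivMod using (n%ℕd<d; a≡a%ℕn+[a/ℕn]*n; _/ℕ_)
open import Data.Integer.Tactic.RingSolver using (solve-∀)
open import Data.Fin using (Fin; toℕ; fromℕ<)
open import Data.Fin.Properties using (toℕ-fromℕ<; toℕ-injective; toℕ<n)
open import Data.Parity.Base as ℙ using (Parity; 0ℙ; 1ℙ)
import Data.Parity.Properties as ℙP
open import Data.Product using (Σ; _,_; _×_; proj₁; proj₂)
open import Data.Sum using (_⊎_; inj₁; inj₂)
open import Data.Empty using (⊥; ⊥-elim)
open import Function.Bundles using (mk↔ₛ′)
open import Relation.Binary.Bundles using (Setoid)
import Relation.Binary.Reasoning.Setoid as SetoidReasoning
open import Relation.Binary.PropositionalEquality

record Automorphism {A : Set} (E : A → A → Set) : Set where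
  field
    to from        : A → A
    to∘from        : ∀ x → to (from x) ≡ x
    from∘to        : ∀ x → from (to x) ≡ x
    to-preserves   : ∀ {x y} → E x y → E (to x) (to y)
    from-preserves : ∀ {x y} → E x y → E (from x) (from y)

module _ {A : Set} {E : A → A → Set} where

  open Automorphism

  involution : (f : A → A) → (∀ x → f (f x) ≡ x) → (∀ {x y} → E x y → E (f x) (f y)) →
               Automorphism E
  involution f f∘f preserves = record
    { to = f ; from = f ; to∘from = f∘f ; from∘to = f∘f
    ; to-preserves = preserves ; from-preserves = preserves }

  infixr 9 _∘ᴬ_
  _∘ᴬ_ : Automorphism E → Automorphism E → Automorphism E
  g ∘ᴬ f = record
    { to = λ x → to g (to f x)
    ; from = λ x → from f (from g x)
    ; to∘from = λ x → trans (cong (to g) (to∘from f (from g x))) (to∘from g x)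
    ; from∘to = λ x → trans (cong (from f) (from∘to g (to f x))) (from∘to f x)
    ; to-preserves = λ e → to-preserves g (to-preserves f e)
    ; from-preserves = λ e → from-preserves f (from-preserves g e) }

  inverseᴬ : Automorphism E → Automorphism E
  inverseᴬ f = record
    { to = from f ; from = to f ; to∘from = from∘to f ; from∘to = to∘from f
    ; to-preserves = from-preserves f ; from-preserves = to-preserves f }

  transitive-from-base : (o : A) (move : A → Automorphism E) → (∀ x → to (move x) o ≡ x) →
                         VertexTransitive E
  transitive-from-base o move moves-o x y = bijection , is-automorphism , sends-x-to-y
    where
      g : Automorphism E
      g = move y ∘ᴬ inverseᴬ (move x)

      bijection = mk↔ₛ′ (to g) (from g) (to∘from g) (from∘to g)

      is-automorphism : IsAutomorphism E bijection
      is-automorphism a b =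
        to-preserves g , λ e → subst₂ E (from∘to g a) (from∘to g b) (from-preserves g e)

      x-comes-from-o : from (move x) x ≡ o
      x-comes-from-o = trans (cong (from (move x)) (sym (moves-o x))) (from∘to (move x) o)

      sends-x-to-y : to g x ≡ y
      sends-x-to-y = trans (cong (to (move y)) x-comes-from-o) (moves-o y)

symmetric-closure-preserves : {A : Set} {R S : A → A → Set} (f : A → A) →
  (∀ {x y} → S x y → S y x) → (∀ {x y} → R x y → S (f x) (f y)) →
  ∀ {x y} → R x y ⊎ R y x → S (f x) (f y)
symmetric-closure-preserves f _     preserves (inj₁ e) = preserves e
symmetric-closure-preserves f S-sym preserves (inj₂ e) = S-sym (preserves e)

module Congruence (N : ℤ) where

  infix 4 _≈_
  record _≈_ (x y : ℤ) : Set where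
    constructor congruent
    field
      quotient : ℤ
      witness  : x ≡ y + quotient * N

  ≈-reflexive : ∀ {x y} → x ≡ y → x ≈ y
  ≈-reflexive {x} refl = congruent (+ 0) (plus-zero-multiple x N)
    where plus-zero-multiple : ∀ x N → x ≡ x + + 0 * N
          plus-zero-multiple = solve-∀

  ≈-refl : ∀ {x} → x ≈ x
  ≈-refl = ≈-reflexive refl

  ≈-sym : ∀ {x y} → x ≈ y → y ≈ x
  ≈-sym {y = y} (congruent q e) =
    congruent (- q) (trans (move-multiple y q N) (cong (λ u → u + - q * N) (sym e)))
    where move-multiple : ∀ y q N → y ≡ y + q * N + - q * N
          move-multiple = solve-∀

  ≈-trans : ∀ {x y w} → x ≈ y → y ≈ w → x ≈ w
  ≈-trans {w = w} (congruent q₁ e₁) (congruent q₂ e₂) =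
    congruent (q₂ + q₁) (trans e₁ (trans (cong (λ u → u + q₁ * N) e₂) (collect w q₂ q₁ N)))
    where collect : ∀ w a b N → w + a * N + b * N ≡ w + (a + b) * N
          collect = solve-∀

  infixl 6 _+-cong_ _-cong_
  _+-cong_ : ∀ {a b c d} → a ≈ b → c ≈ d → a + c ≈ b + d
  _+-cong_ {b = b} {d = d} (congruent p e₁) (congruent q e₂) =
    congruent (p + q) (trans (cong₂ _+_ e₁ e₂) (collect b d p q N))
    where collect : ∀ b d p q N → b + p * N + (d + q * N) ≡ b + d + (p + q) * N
          collect = solve-∀

  neg-cong : ∀ {a b} → a ≈ b → - a ≈ - b
  neg-cong {b = b} (congruent q e) = congruent (- q) (trans (cong -_ e) (distribute b q N))
    where distribute : ∀ b q N → - (b + q * N) ≡ - b + - q * N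
          distribute = solve-∀

  _-cong_ : ∀ {a b c d} → a ≈ b → c ≈ d → a - c ≈ b - d
  p -cong q = p +-cong neg-cong q

  period : ∀ x → x + N ≈ x
  period x = congruent (+ 1) (cong (λ u → x + u) (sym (ℤP.*-identityˡ N)))

  ≈-setoid : Setoid _ _
  ≈-setoid = record
    { Carrier = ℤ ; _≈_ = _≈_
    ; isEquivalence = record { refl = ≈-refl ; sym = ≈-sym ; trans = ≈-trans } }

  module ≈-Reasoning = SetoidReasoning ≈-setoid

module Residues (m : ℕ) where

  n : ℕ
  n = suc m

  N : ℤ
  N = + n

  open Congruence N public

  z : Fin n → ℤ
  z i = + toℕ i

  ⟦_⟧ : ℤ → Fin n
  ⟦ e ⟧ = fromℕ< (n%ℕd<d e n)

  z-⟦⟧ : ∀ e → z ⟦ e ⟧ ≈ e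
  z-⟦⟧ e = ≈-sym (congruent (e /ℕ n)
    (trans (a≡a%ℕn+[a/ℕn]*n e n) (cong (λ u → + u + (e /ℕ n) * N) (sym (toℕ-fromℕ< _)))))

  private
    lift-multiple : ∀ {a b q} → + a ≡ + b + + q * N → a ≡ b ℕ.+ q ℕ.* n
    lift-multiple {b = b} {q} e = ℤP.+-injective
      (trans e (trans (cong (λ u → + b + u) (sym (ℤP.pos-* q n))) (sym (ℤP.pos-+ b (q ℕ.* n)))))

    small-multiple : ∀ {a b} q → a < n → a ≡ b ℕ.+ q ℕ.* n → a ≡ b
    small-multiple {b = b} zero    _   e = trans e (ℕP.+-identityʳ b)
    small-multiple {b = b} (suc q) a<n e =
      ⊥-elim (ℕP.<⇒≱ a<n (ℕP.≤-trans (ℕP.m≤m+n n (q ℕ.* n))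
                           (ℕP.≤-trans (ℕP.m≤n+m _ b) (ℕP.≤-reflexive (sym e)))))

  z-injective : ∀ {i j} → z i ≈ z j → i ≡ j
  z-injective {i} {j} (congruent (+ q) e) =
    toℕ-injective (small-multiple q (toℕ<n i) (lift-multiple {q = q} e))
  z-injective {i} {j} (congruent -[1+ q ] e) =
    toℕ-injective (sym (small-multiple (suc q) (toℕ<n j)
                         (lift-multiple {b = toℕ i} {q = suc q} (_≈_.witness (≈-sym (congruent -[1+ q ] e))))))

  ⟦⟧-≈ : ∀ {e i} → e ≈ z i → ⟦ e ⟧ ≡ i
  ⟦⟧-≈ {e} p = z-injective (≈-trans (z-⟦⟧ e) p)

  z-+ₘ : ∀ i d → z (i +ₘ d) ≈ z i + + d
  z-+ₘ i d = ≈-trans (≈-reflexive (cong +_ (toℕ-fromℕ< (m%n<n x n))))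
               (≈-trans (≈-sym (congruent (+ (x / n)) x-expanded)) (≈-reflexive (ℤP.pos-+ (toℕ i) d)))
    where
      x : ℕ
      x = toℕ i ℕ.+ d
      x-expanded : + x ≡ + (x % n) + + (x / n) * N
      x-expanded = trans (cong +_ (m≡m%n+[m/n]*n x n))
                         (trans (ℤP.pos-+ (x % n) _) (cong (λ u → + (x % n) + u) (ℤP.pos-* (x / n) n)))

-- The graph T₁(k, r, 1) for k = k₀ + 1 (so that ℤ_{2k} is not empty).
module T₁ (k₀ r : ℕ) where

  k : ℕ
  k = suc k₀

  open Residues (ℕ.pred (2 ℕ.* k)) public

  K R : ℤ
  K = + k
  R = + r

  N≡K+K : N ≡ K + K
  N≡K+K = trans (cong +_ (cong (k ℕ.+_) (ℕP.+-identityʳ k))) (ℤP.pos-+ k k)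

  double-period : ∀ x → x + (K + K) ≈ x
  double-period x = subst (λ M → x + M ≈ x) N≡K+K (period x)

  Graph : Vertex k → Vertex k → Set
  Graph = Adj k r 1

  Graph-sym : ∀ {x y} → Graph x y → Graph y x
  Graph-sym (inj₁ e) = inj₂ e
  Graph-sym (inj₂ e) = inj₁ e

  -- The five families of generating edges X_i Y_{i+d}, indexed by their kinds and offset d.
  data Offset : Kind → Kind → ℕ → Set where
    uu  : Offset U U k
    uv  : Offset U V 0
    uw  : Offset U W 0
    vwr : Offset V W r
    vws : Offset V W 1

  private
    shifted : ∀ d {i j} → z j ≈ z i + + d → i +ₘ d ≡ j
    shifted d {i} e = z-injective (≈-trans (z-+ₘ i d) (≈-sym e))

    unshifted : ∀ {i j} → z j ≈ z i + + 0 → i ≡ j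
    unshifted {i} e = z-injective (≈-sym (≈-trans e (≈-reflexive (ℤP.+-identityʳ (z i)))))

  offset-edge : ∀ {X Y d i j} → Offset X Y d → z j ≈ z i + + d → Edge k r 1 (X , i) (Y , j)
  offset-edge {i = i} uu  e = subst (λ j → Edge k r 1 (U , i) (U , j)) (shifted k e) (uu i)
  offset-edge {i = i} uv  e = subst (λ j → Edge k r 1 (U , i) (V , j)) (unshifted e) (uv i)
  offset-edge {i = i} uw  e = subst (λ j → Edge k r 1 (U , i) (W , j)) (unshifted e) (uw i)
  offset-edge {i = i} vwr e = subst (λ j → Edge k r 1 (V , i) (W , j)) (shifted r e) (vwr i)
  offset-edge {i = i} vws e = subst (λ j → Edge k r 1 (V , i) (W , j)) (shifted 1 e) (vws i)

  data Linked : Vertex k → Vertex k → Set where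
    linked : ∀ {X Y d i j} → Offset X Y d → z j ≈ z i + + d → Linked (X , i) (Y , j)

  edge-linked : ∀ {x y} → Edge k r 1 x y → Linked x y
  edge-linked (uu i)  = linked uu (z-+ₘ i k)
  edge-linked (uv i)  = linked uv (≈-reflexive (sym (ℤP.+-identityʳ (z i))))
  edge-linked (uw i)  = linked uw (≈-reflexive (sym (ℤP.+-identityʳ (z i))))
  edge-linked (vwr i) = linked vwr (z-+ₘ i r)
  edge-linked (vws i) = linked vws (z-+ₘ i 1)

  preserves-by-offsets : (f : Vertex k → Vertex k) →
    (∀ {X Y d} → Offset X Y d → ∀ i j → z j ≈ z i + + d → Graph (f (X , i)) (f (Y , j))) →
    ∀ {x y} → Graph x y → Graph (f x) (f y)
  preserves-by-offsets f link =
    symmetric-closure-preserves {R = Edge k r 1} {S = Graph} f Graph-sym (λ e → via (edge-linked e))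
    where via : ∀ {x y} → Linked x y → Graph (f x) (f y)
          via (linked {i = i} {j} o e) = link o i j e

  rotation : ℤ → Vertex k → Vertex k
  rotation c (X , i) = X , ⟦ z i + c ⟧

  rotation-link : ∀ c {d} i j → z j ≈ z i + + d → z ⟦ z j + c ⟧ ≈ z ⟦ z i + c ⟧ + + d
  rotation-link c {d} i j e = begin
    z ⟦ z j + c ⟧        ≈⟨ z-⟦⟧ (z j + c) ⟩
    z j + c              ≈⟨ e +-cong ≈-refl {c} ⟩
    z i + + d + c        ≡⟨ swap-last (z i) (+ d) c ⟩
    z i + c + + d        ≈⟨ ≈-sym (z-⟦⟧ (z i + c)) +-cong ≈-refl {+ d} ⟩
    z ⟦ z i + c ⟧ + + d  ∎
    where
      open ≈-Reasoning
      swap-last : ∀ a b c → a + b + c ≡ a + c + b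
      swap-last = solve-∀

  rotation-preserves : ∀ c {x y} → Graph x y → Graph (rotation c x) (rotation c y)
  rotation-preserves c = preserves-by-offsets (rotation c)
    (λ o i j e → inj₁ (offset-edge o (rotation-link c i j e)))

  rotation-cancel : ∀ c c' → c + c' ≡ + 0 → ∀ x → rotation c' (rotation c x) ≡ x
  rotation-cancel c c' cancels (X , i) = cong (X ,_) (⟦⟧-≈ (begin
    z ⟦ z i + c ⟧ + c'  ≈⟨ z-⟦⟧ (z i + c) +-cong ≈-refl {c'} ⟩
    z i + c + c'        ≡⟨ ℤP.+-assoc (z i) c c' ⟩
    z i + (c + c')      ≡⟨ cong (λ u → z i + u) cancels ⟩
    z i + + 0           ≡⟨ ℤP.+-identityʳ (z i) ⟩
    z i                 ∎))
    where open ≈-Reasoning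

  rotationᴬ : ℤ → Automorphism Graph
  rotationᴬ c = record
    { to = rotation c ; from = rotation (- c)
    ; to∘from = rotation-cancel (- c) c (ℤP.+-inverseˡ c)
    ; from∘to = rotation-cancel c (- c) (ℤP.+-inverseʳ c)
    ; to-preserves = rotation-preserves c
    ; from-preserves = rotation-preserves (- c) }

  reflect : Kind × ℤ → ℤ → Vertex k
  reflect (Y , c) a = Y , ⟦ c - a ⟧

  -- How the images of an edge of offset d under i ↦ cX - i and j ↦ cY - j are joined:
  -- by an edge of offset d' in the same or in the reverse direction, which is a
  -- congruence between the two centres.
  data CentresLinked (d : ℕ) : Kind × ℤ → Kind × ℤ → Set where
    forward  : ∀ {X Y d' cX cY} → Offset X Y d' → cY - + d ≈ cX + + d' →
               CentresLinked d (X , cX) (Y , cY)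
    backward : ∀ {X Y d' cX cY} → Offset Y X d' → cX + + d ≈ cY + + d' →
               CentresLinked d (X , cX) (Y , cY)

  centres-link : ∀ {d x y} → CentresLinked d x y → ∀ a b → b ≈ a + + d →
                 Graph (reflect x a) (reflect y b)
  centres-link {d} (forward {d' = d'} {cX} {cY} o centres) a b e = inj₁ (offset-edge o (begin
    z ⟦ cY - b ⟧          ≈⟨ z-⟦⟧ (cY - b) ⟩
    cY - b                ≈⟨ ≈-refl {cY} -cong e ⟩
    cY - (a + + d)        ≡⟨ regroup cY a (+ d) ⟩
    cY - + d - a          ≈⟨ centres -cong ≈-refl {a} ⟩
    cX + + d' - a         ≡⟨ swap cX (+ d') a ⟩
    cX - a + + d'         ≈⟨ ≈-sym (z-⟦⟧ (cX - a)) +-cong ≈-refl {+ d'} ⟩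
    z ⟦ cX - a ⟧ + + d'   ∎))
    where
      open ≈-Reasoning
      regroup : ∀ c a d → c - (a + d) ≡ c - d - a
      regroup = solve-∀
      swap : ∀ c d a → c + d - a ≡ c - a + d
      swap = solve-∀
  centres-link {d} (backward {d' = d'} {cX} {cY} o centres) a b e = Graph-sym (inj₁ (offset-edge o (begin
    z ⟦ cX - a ⟧          ≈⟨ z-⟦⟧ (cX - a) ⟩
    cX - a                ≡⟨ shift-both cX a (+ d) ⟩
    cX + + d - (a + + d)  ≈⟨ centres -cong ≈-sym e ⟩
    cY + + d' - b         ≡⟨ swap cY (+ d') b ⟩
    cY - b + + d'         ≈⟨ ≈-sym (z-⟦⟧ (cY - b)) +-cong ≈-refl {+ d'} ⟩
    z ⟦ cY - b ⟧ + + d'   ∎)))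
    where
      open ≈-Reasoning
      shift-both : ∀ c a d → c - a ≡ c + d - (a + d)
      shift-both = solve-∀
      swap : ∀ c d a → c + d - a ≡ c - a + d
      swap = solve-∀

  -- e has parity 0ℙ or 1ℙ when it is congruent to 2c or to 1 + 2c; since the modulus 2k is
  -- even, this is well defined (parity-unique).
  HasParity : ℤ → Parity → Set
  HasParity e 0ℙ = Σ ℤ λ c → e ≈ c + c
  HasParity e 1ℙ = Σ ℤ λ c → e ≈ + 1 + (c + c)

  parity-≈ : ∀ {a b} p → a ≈ b → HasParity a p → HasParity b p
  parity-≈ 0ℙ a≈b (c , e) = c , ≈-trans (≈-sym a≈b) e
  parity-≈ 1ℙ a≈b (c , e) = c , ≈-trans (≈-sym a≈b) e

  parity-+ : ∀ {a b} p q → HasParity a p → HasParity b q → HasParity (a + b) (p ℙ.+ q)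
  parity-+ 0ℙ 0ℙ (c , e) (c' , e') = c + c' , ≈-trans (e +-cong e') (≈-reflexive (even+even c c'))
    where even+even : ∀ c c' → c + c + (c' + c') ≡ c + c' + (c + c')
          even+even = solve-∀
  parity-+ 0ℙ 1ℙ (c , e) (c' , e') = c + c' , ≈-trans (e +-cong e') (≈-reflexive (even+odd c c'))
    where even+odd : ∀ c c' → c + c + (+ 1 + (c' + c')) ≡ + 1 + (c + c' + (c + c'))
          even+odd = solve-∀
  parity-+ 1ℙ 0ℙ (c , e) (c' , e') = c + c' , ≈-trans (e +-cong e') (≈-reflexive (odd+even c c'))
    where odd+even : ∀ c c' → + 1 + (c + c) + (c' + c') ≡ + 1 + (c + c' + (c + c'))
          odd+even = solve-∀
  parity-+ 1ℙ 1ℙ (c , e) (c' , e') = c + c' + + 1 , ≈-trans (e +-cong e') (≈-reflexive (odd+odd c c'))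
    where odd+odd : ∀ c c' → + 1 + (c + c) + (+ 1 + (c' + c')) ≡ c + c' + + 1 + (c + c' + + 1)
          odd+odd = solve-∀

  parity-neg : ∀ {a} p → HasParity a p → HasParity (- a) p
  parity-neg 0ℙ (c , e) = - c , ≈-trans (neg-cong e) (≈-reflexive (neg-even c))
    where neg-even : ∀ c → - (c + c) ≡ - c + - c
          neg-even = solve-∀
  parity-neg 1ℙ (c , e) = - c - + 1 , ≈-trans (neg-cong e) (≈-reflexive (neg-odd c))
    where neg-odd : ∀ c → - (+ 1 + (c + c)) ≡ + 1 + (- c - + 1 + (- c - + 1))
          neg-odd = solve-∀

  parity-reflect : ∀ {c a} p → HasParity c 0ℙ → HasParity a p → HasParity (c - a) p
  parity-reflect p c-even a-has-p = parity-+ 0ℙ p c-even (parity-neg p a-has-p)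

  parity-nat : ∀ a → HasParity (+ a) (parity a)
  parity-nat zero          = + 0 , ≈-refl
  parity-nat (suc zero)    = + 0 , ≈-refl
  parity-nat (suc (suc a)) = parity-+ 0ℙ (parity a) (+ 1 , ≈-refl) (parity-nat a)

  parity-of : ∀ i → HasParity (z i) (parity (toℕ i))
  parity-of i = parity-nat (toℕ i)

  private
    one≢double : ∀ c → + 1 ≢ c + c
    one≢double (+ zero)  ()
    one≢double (+ suc m) e =
      ℕP.0≢1+n (trans (ℕP.suc-injective (ℤP.+-injective e)) (ℕP.+-suc m m))
    one≢double -[1+ m ]  ()

    -- 2c ≡ 1 + 2c' + q·2k would make 1 even
    even≉odd : ∀ {a} → HasParity a 0ℙ → HasParity a 1ℙ → ⊥
    even≉odd (c , a≈even) (c' , a≈odd) with ≈-trans (≈-sym a≈odd) a≈even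
    ... | congruent q e = one≢double (c - c' + q * K) (begin
      + 1                                     ≡⟨ isolate-one c' ⟩
      + 1 + (c' + c') - (c' + c')             ≡⟨ cong (λ u → u - (c' + c')) e ⟩
      c + c + q * N - (c' + c')               ≡⟨ cong (λ M → c + c + q * M - (c' + c')) N≡K+K ⟩
      c + c + q * (K + K) - (c' + c')         ≡⟨ halve c c' q K ⟩
      c - c' + q * K + (c - c' + q * K)       ∎)
      where
        open ≡-Reasoning
        isolate-one : ∀ c' → + 1 ≡ + 1 + (c' + c') - (c' + c')
        isolate-one = solve-∀
        halve : ∀ c c' q K → c + c + q * (K + K) - (c' + c') ≡ c - c' + q * K + (c - c' + q * K)
        halve = solve-∀

  parity-unique : ∀ {a} p q → HasParity a p → HasParity a q → p ≡ q
  parity-unique 0ℙ 0ℙ _    _    = refl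
  parity-unique 1ℙ 1ℙ _    _    = refl
  parity-unique 0ℙ 1ℙ even odd  = ⊥-elim (even≉odd even odd)
  parity-unique 1ℙ 0ℙ odd  even = ⊥-elim (even≉odd even odd)

  parity-along : ∀ {i j} d → z j ≈ z i + + d → parity (toℕ j) ≡ parity (toℕ i) ℙ.+ parity d
  parity-along {i} {j} d e = parity-unique _ _ (parity-of j)
    (parity-≈ _ (≈-sym e) (parity-+ (parity (toℕ i)) (parity d) (parity-of i) (parity-nat d)))

  -- Reflection data: for each kind and parity, the target kind and the centre of i ↦ c - i.
  ReflectionData : Set
  ReflectionData = Kind → Parity → Kind × ℤ

  SelfInverse : ReflectionData → Set
  SelfInverse D = ∀ X p → D (proj₁ (D X p)) p ≡ (X , proj₂ (D X p))

  EvenCentres : ReflectionData → Set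
  EvenCentres D = ∀ X p → HasParity (proj₂ (D X p)) 0ℙ

  LinksCentres : ReflectionData → Set
  LinksCentres D = ∀ {X Y d} → Offset X Y d → ∀ p → CentresLinked d (D X p) (D Y (p ℙ.+ parity d))

  reflection : ReflectionData → Vertex k → Vertex k
  reflection D (X , i) = reflect (D X (parity (toℕ i))) (z i)

  -- If D undoes itself and all centres are even (so reflecting keeps the parity),
  -- then the reflection it defines is an involution.
  reflection-involutive : (D : ReflectionData) → SelfInverse D → EvenCentres D →
    ∀ x → reflection D (reflection D x) ≡ x
  reflection-involutive D D-involutive centre-even (X , i) = begin
    reflect (D Y (parity (toℕ j))) (z j)  ≡⟨ cong (λ q → reflect (D Y q) (z j)) parity-kept ⟩
    reflect (D Y p) (z j)                 ≡⟨ cong (λ v → reflect v (z j)) (D-involutive X p) ⟩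
    reflect (X , c) (z j)                 ≡⟨ cong (X ,_) (⟦⟧-≈ reflected-back) ⟩
    (X , i)                               ∎
    where
      open ≡-Reasoning
      p = parity (toℕ i)
      Y = proj₁ (D X p)
      c = proj₂ (D X p)
      j = ⟦ c - z i ⟧

      parity-kept : parity (toℕ j) ≡ p
      parity-kept = parity-unique _ _ (parity-of j)
        (parity-≈ p (≈-sym (z-⟦⟧ (c - z i))) (parity-reflect p (centre-even X p) (parity-of i)))

      reflected-back : c - z j ≈ z i
      reflected-back = ≈-trans (≈-refl {c} -cong z-⟦⟧ (c - z i)) (≈-reflexive (reflect-twice c (z i)))
        where reflect-twice : ∀ c a → c - (c - a) ≡ a
              reflect-twice = solve-∀

  reflection-preserves : (D : ReflectionData) → LinksCentres D →
    ∀ {x y} → Graph x y → Graph (reflection D x) (reflection D y)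
  reflection-preserves D linked-centres = preserves-by-offsets (reflection D) link
    where
      link : ∀ {X Y d} → Offset X Y d → ∀ i j → z j ≈ z i + + d →
             Graph (reflection D (X , i)) (reflection D (Y , j))
      link {X} {Y} {d} o i j e =
        subst (λ q → Graph (reflection D (X , i)) (reflect (D Y q) (z j))) (sym (parity-along d e))
              (centres-link (linked-centres o (parity (toℕ i))) (z i) (z j) e)

  reflectionᴬ : (D : ReflectionData) → SelfInverse D → EvenCentres D → LinksCentres D →
                Automorphism Graph
  reflectionᴬ D D-involutive centre-even linked-centres =
    involution (reflection D) (reflection-involutive D D-involutive centre-even)
               (reflection-preserves D linked-centres)

  swap-VW : Kind → Kind
  swap-VW U = U
  swap-VW V = W
  swap-VW W = V

  mirror-data : ReflectionData
  mirror-data X _ = swap-VW X , + 0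

  -- the edges u_iu_{i+k} use -k ≡ k (mod 2k)
  mirror-centres : LinksCentres mirror-data
  mirror-centres uu  _ =
    forward uu (≈-sym (≈-trans (≈-reflexive (minus-plus-double K)) (double-period (+ 0 - K))))
    where minus-plus-double : ∀ K → + 0 + K ≡ + 0 - K + (K + K)
          minus-plus-double = solve-∀
  mirror-centres uv  _ = forward uw ≈-refl
  mirror-centres uw  _ = forward uv ≈-refl
  mirror-centres vwr _ = backward vwr ≈-refl
  mirror-centres vws _ = backward vws ≈-refl

  mirrorᴬ : Automorphism Graph
  mirrorᴬ = reflectionᴬ mirror-data (λ { U _ → refl ; V _ → refl ; W _ → refl })
                                    (λ _ _ → + 0 , ≈-refl) mirror-centres

  module Twist (k-odd : parity k ≡ 1ℙ) (r-even : parity r ≡ 0ℙ) (r-double : R + R ≈ K + + 3) where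

    twist-data : ReflectionData
    twist-data U 0ℙ = V , + 0
    twist-data U 1ℙ = W , K + + 1
    twist-data V 0ℙ = U , + 0
    twist-data V 1ℙ = V , R - + 2
    twist-data W 0ℙ = W , R
    twist-data W 1ℙ = U , K + + 1

    twist-data-involutive : SelfInverse twist-data
    twist-data-involutive U 0ℙ = refl
    twist-data-involutive U 1ℙ = refl
    twist-data-involutive V 0ℙ = refl
    twist-data-involutive V 1ℙ = refl
    twist-data-involutive W 0ℙ = refl
    twist-data-involutive W 1ℙ = refl

    R-even : HasParity R 0ℙ
    R-even = subst (HasParity R) r-even (parity-nat r)

    K+1-even : HasParity (K + + 1) 0ℙ
    K+1-even = subst (HasParity (K + + 1)) (trans (ℙP.+-homo-+ k 1) (cong (ℙ._+ 1ℙ) k-odd))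
                     (parity-nat (k ℕ.+ 1))

    twist-centre-even : EvenCentres twist-data
    twist-centre-even U 0ℙ = + 0 , ≈-refl
    twist-centre-even U 1ℙ = K+1-even
    twist-centre-even V 0ℙ = + 0 , ≈-refl
    twist-centre-even V 1ℙ = parity-+ 0ℙ 0ℙ R-even (-[1+ 0 ] , ≈-refl)
    twist-centre-even W 0ℙ = R-even
    twist-centre-even W 1ℙ = K+1-even

    -- the one congruence between centres that uses 2r ≡ k + 3
    centres-r-k : R - + 2 + R ≈ K + + 1 + + 0
    centres-r-k = begin
      R - + 2 + R     ≡⟨ collect R ⟩
      R + R - + 2     ≈⟨ r-double -cong ≈-refl { + 2} ⟩
      K + + 3 - + 2   ≡⟨ simplify K ⟩
      K + + 1 + + 0   ∎
      where
        open ≈-Reasoning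
        collect : ∀ R → R - + 2 + R ≡ R + R - + 2
        collect = solve-∀
        simplify : ∀ K → K + + 3 - + 2 ≡ K + + 1 + + 0
        simplify = solve-∀

    -- edges u_iu_{i+k}: the parity changes since k is odd
    centres-uu : ∀ p → CentresLinked k (twist-data U p) (twist-data U (p ℙ.+ 1ℙ))
    centres-uu 0ℙ = forward vws (≈-reflexive (cancel K))
      where cancel : ∀ K → K + + 1 - K ≡ + 0 + + 1
            cancel = solve-∀
    centres-uu 1ℙ = backward vws (≈-trans (≈-reflexive (split K)) (double-period (+ 0 + + 1)))
      where split : ∀ K → K + + 1 + K ≡ + 0 + + 1 + (K + K)
            split = solve-∀

    -- edges v_iw_{i+r}: the parity is kept since r is even
    centres-vwr : ∀ p → CentresLinked r (twist-data V p) (twist-data W (p ℙ.+ 0ℙ))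
    centres-vwr 0ℙ = forward uw (≈-reflexive (cancel R))
      where cancel : ∀ R → R - R ≡ + 0 + + 0
            cancel = solve-∀
    centres-vwr 1ℙ = backward uv centres-r-k

    twist-centres : LinksCentres twist-data
    twist-centres uu p =
      subst (λ q → CentresLinked k (twist-data U p) (twist-data U (p ℙ.+ q))) (sym k-odd) (centres-uu p)
    twist-centres vwr p =
      subst (λ q → CentresLinked r (twist-data V p) (twist-data W (p ℙ.+ q))) (sym r-even) (centres-vwr p)
    twist-centres uv 0ℙ = backward uv ≈-refl
    twist-centres uv 1ℙ = backward vwr (≈-sym centres-r-k)
    twist-centres uw 0ℙ = forward vwr (≈-reflexive (subtract-zero R))
      where subtract-zero : ∀ R → R - + 0 ≡ + 0 + R
            subtract-zero = solve-∀
    twist-centres uw 1ℙ = backward uw ≈-refl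
    twist-centres vws 0ℙ = forward uu (≈-reflexive (cancel K))
      where cancel : ∀ K → K + + 1 - + 1 ≡ + 0 + K
            cancel = solve-∀
    twist-centres vws 1ℙ = forward vws (≈-reflexive (split R))
      where split : ∀ R → R - + 1 ≡ R - + 2 + + 1
            split = solve-∀

    twistᴬ : Automorphism Graph
    twistᴬ = reflectionᴬ twist-data twist-data-involutive twist-centre-even twist-centres

    origin : Vertex k
    origin = U , Data.Fin.zero

    index-v₀ : Fin n
    index-v₀ = ⟦ + 0 - + 0 ⟧

    move : Vertex k → Automorphism Graph
    move (U , i) = rotationᴬ (z i)
    move (V , i) = rotationᴬ (z i) ∘ᴬ twistᴬ
    move (W , i) = rotationᴬ (z i) ∘ᴬ mirrorᴬ ∘ᴬ twistᴬ

    rotation-from-zero : ∀ X i j → z j ≈ + 0 → rotation (z i) (X , j) ≡ (X , i)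
    rotation-from-zero X i j e = cong (X ,_) (⟦⟧-≈ (e +-cong ≈-refl {z i}))

    move-origin : ∀ x → Automorphism.to (move x) origin ≡ x
    move-origin (U , i) = rotation-from-zero U i Data.Fin.zero ≈-refl
    move-origin (V , i) = rotation-from-zero V i index-v₀ (z-⟦⟧ (+ 0 - + 0))
    move-origin (W , i) = rotation-from-zero W i ⟦ + 0 - z index-v₀ ⟧
      (≈-trans (z-⟦⟧ (+ 0 - z index-v₀)) (≈-refl {+ 0} -cong z-⟦⟧ (+ 0 - + 0)))

    vertex-transitive : VertexTransitive Graph
    vertex-transitive = transitive-from-base origin move move-origin

T₁-vertex-transitive : ∀ k r → parity k ≡ 1ℙ → parity r ≡ 0ℙ →
  Σ ℕ (λ q → 2 ℕ.* r ≡ k ℕ.+ 3 ℕ.+ q ℕ.* (2 ℕ.* k)) → VertexTransitive (Adj k r 1)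
T₁-vertex-transitive zero     r () _ _
T₁-vertex-transitive (suc k₀) r k-odd r-even (q , double) =
  Twist.vertex-transitive k-odd r-even r-double
  where
    open T₁ k₀ r

    r-double : R + R ≈ K + + 3
    r-double = congruent (+ q) (begin
      + (r ℕ.+ r)                           ≡⟨ cong (λ u → + (r ℕ.+ u)) (sym (ℕP.+-identityʳ r)) ⟩
      + (2 ℕ.* r)                           ≡⟨ cong +_ double ⟩
      + (k ℕ.+ 3 ℕ.+ q ℕ.* (2 ℕ.* k))       ≡⟨ ℤP.pos-+ (k ℕ.+ 3) _ ⟩
      + (k ℕ.+ 3) + + (q ℕ.* (2 ℕ.* k))     ≡⟨ cong (λ u → + (k ℕ.+ 3) + u) (ℤP.pos-* q (2 ℕ.* k)) ⟩
      K + + 3 + + q * N                     ∎)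
      where open ≡-Reasoning

parity-2* : ∀ m → parity (2 ℕ.* m) ≡ 0ℙ
parity-2* m = ℙP.*-homo-* 2 m

parity-1+2* : ∀ m → parity (1 ℕ.+ 2 ℕ.* m) ≡ 1ℙ
parity-1+2* m = trans (ℙP.+-homo-+ 1 (2 ℕ.* m)) (cong (1ℙ ℙ.+_) (parity-2* m))

RStarSpec : ℕ → Set
RStarSpec k = parity k ≡ 1ℙ × parity (rstar k) ≡ 0ℙ ×
              Σ ℕ (λ q → 2 ℕ.* rstar k ≡ k ℕ.+ 3 ℕ.+ q ℕ.* (2 ℕ.* k))

rstar-spec-from : ∀ k t h q → k ≡ 1 ℕ.+ 2 ℕ.* t → rstar k ≡ 2 ℕ.* h →
                  2 ℕ.* (2 ℕ.* h) ≡ k ℕ.+ 3 ℕ.+ q ℕ.* (2 ℕ.* k) → RStarSpec k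
rstar-spec-from k t h q k≡ r≡ double =
  trans (cong parity k≡) (parity-1+2* t) ,
  trans (cong parity r≡) (parity-2* h) ,
  (q , trans (cong (2 ℕ.*_) r≡) double)

rstar-when-1 : ∀ k → k % 4 ≡ 1 → rstar k ≡ ⌊ k ℕ.+ 3 /2⌋
rstar-when-1 k p rewrite p = refl

rstar-when-3 : ∀ k → k % 4 ≡ 3 → rstar k ≡ ⌊ k ℕ.+ 3 /2⌋ ℕ.+ k
rstar-when-3 k p rewrite p = refl

-- k = 4u + 1:  r* = 2u + 2 and 2r* = k + 3
rstar-spec-1 : ∀ u → RStarSpec (1 ℕ.+ u ℕ.* 4)
rstar-spec-1 u = rstar-spec-from k (2 ℕ.* u) (u ℕ.+ 1) 0 (form u) r≡ (double u)
  where
    k w : ℕ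
    k = 1 ℕ.+ u ℕ.* 4
    w = 2 ℕ.* (u ℕ.+ 1)
    form : ∀ u → 1 ℕ.+ u ℕ.* 4 ≡ 1 ℕ.+ 2 ℕ.* (2 ℕ.* u)
    form = ℕ-Solver.solve-∀
    k+3 : ∀ u → 1 ℕ.+ u ℕ.* 4 ℕ.+ 3 ≡ 2 ℕ.* (u ℕ.+ 1) ℕ.+ 2 ℕ.* (u ℕ.+ 1)
    k+3 = ℕ-Solver.solve-∀
    double : ∀ u → 2 ℕ.* (2 ℕ.* (u ℕ.+ 1)) ≡ 1 ℕ.+ u ℕ.* 4 ℕ.+ 3 ℕ.+ 0 ℕ.* (2 ℕ.* (1 ℕ.+ u ℕ.* 4))
    double = ℕ-Solver.solve-∀
    r≡ : rstar k ≡ w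
    r≡ = trans (rstar-when-1 k ([m+kn]%n≡m%n 1 u 4))
               (trans (cong ⌊_/2⌋ (k+3 u)) (sym (ℕP.n≡⌊n+n/2⌋ w)))

-- k = 4u + 3:  r* = (2u + 3) + k = 6u + 6 and 2r* = k + 3 + 2k
rstar-spec-3 : ∀ u → RStarSpec (3 ℕ.+ u ℕ.* 4)
rstar-spec-3 u = rstar-spec-from k (2 ℕ.* u ℕ.+ 1) (3 ℕ.* u ℕ.+ 3) 1 (form u) r≡ (double u)
  where
    k w : ℕ
    k = 3 ℕ.+ u ℕ.* 4
    w = 2 ℕ.* u ℕ.+ 3
    form : ∀ u → 3 ℕ.+ u ℕ.* 4 ≡ 1 ℕ.+ 2 ℕ.* (2 ℕ.* u ℕ.+ 1)
    form = ℕ-Solver.solve-∀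
    k+3 : ∀ u → 3 ℕ.+ u ℕ.* 4 ℕ.+ 3 ≡ 2 ℕ.* u ℕ.+ 3 ℕ.+ (2 ℕ.* u ℕ.+ 3)
    k+3 = ℕ-Solver.solve-∀
    r-value : ∀ u → 2 ℕ.* u ℕ.+ 3 ℕ.+ (3 ℕ.+ u ℕ.* 4) ≡ 2 ℕ.* (3 ℕ.* u ℕ.+ 3)
    r-value = ℕ-Solver.solve-∀
    double : ∀ u → 2 ℕ.* (2 ℕ.* (3 ℕ.* u ℕ.+ 3)) ≡ 3 ℕ.+ u ℕ.* 4 ℕ.+ 3 ℕ.+ 1 ℕ.* (2 ℕ.* (3 ℕ.+ u ℕ.* 4))
    double = ℕ-Solver.solve-∀
    r≡ : rstar k ≡ 2 ℕ.* (3 ℕ.* u ℕ.+ 3)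
    r≡ = trans (rstar-when-3 k ([m+kn]%n≡m%n 3 u 4))
               (trans (cong (λ h → ⌊ h /2⌋ ℕ.+ k) (k+3 u))
                      (trans (cong (ℕ._+ k) (sym (ℕP.n≡⌊n+n/2⌋ w))) (r-value u)))

odd-mod-4 : ∀ k → k % 2 ≡ 1 → k ≡ 1 ℕ.+ (k / 4) ℕ.* 4 ⊎ k ≡ 3 ℕ.+ (k / 4) ℕ.* 4
odd-mod-4 k odd = classify (k % 4) (m%n<n k 4)
  (trans (m∣n⇒o%n%m≡o%m 2 4 k (divides 2 refl)) odd) (m≡m%n+[m/n]*n k 4)
  where
    classify : ∀ s → s < 4 → s % 2 ≡ 1 → k ≡ s ℕ.+ (k / 4) ℕ.* 4 →
               k ≡ 1 ℕ.+ (k / 4) ℕ.* 4 ⊎ k ≡ 3 ℕ.+ (k / 4) ℕ.* 4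
    classify 1 _ _ e = inj₁ e
    classify 3 _ _ e = inj₂ e
    classify 0 _ () _
    classify 2 _ () _
    classify (suc (suc (suc (suc s)))) (ℕ.s≤s (ℕ.s≤s (ℕ.s≤s (ℕ.s≤s ())))) _ _

rstar-spec : ∀ k → k % 2 ≡ 1 → RStarSpec k
rstar-spec k odd with odd-mod-4 k odd
... | inj₁ k≡ = subst RStarSpec (sym k≡) (rstar-spec-1 (k / 4))
... | inj₂ k≡ = subst RStarSpec (sym k≡) (rstar-spec-3 (k / 4))

-- Lemma 4.3: X(k) is vertex-transitive for odd k.
lemma4p3 : (k : ℕ) → 9 ≤ k → k % 2 ≡ 1 → VertexTransitive (AdjX k)
lemma4p3 k _ odd =
  let (k-odd , r-even , r-double) = rstar-spec k odd
  in T₁-vertex-transitive k (rstar k) k-odd r-even r-double
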